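{- Let $\mathbf P=(P,\leq)$ be a poset and $x\in P$. Assume that $y,z\in P$ are complements of $x$ and that $(x,y,z)$ and $(x,z,y)$ are distributive triples of $\mathbf P$. Then $y=z$.
   Context: In a poset $(P,\leq)$, for $A\subseteq P$ let $L(A)=\{p\in P\mid p\leq a\text{ for all }a\in A\}$ and $U(A)=\{p\in P\mid a\leq p\text{ for all }a\in A\}$. One writes $L(a,b)$ for $L(\{a,b\})$, $L(A,a)$ for $L(A\cup\{a\})$, $L(A,B)$ for $L(A\cup B)$, $LU(A)$ for $L(U(A))$, and similarly for $U$. An element $b$ is a complement of $a$ if $LU(a,b)=UL(a,b)=P$. A triple $(a,b,c)$ of elements of $P$ is a distributive triple of $\mathbf P$ if $L\big(U(a,b),c\big)=LU\big(L(a,c),L(b,c)\big)$. -}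

module Defs where

open import Level using (Level; _⊔_; suc)
open import Data.Product using (_×_)
open import Data.Sum using (_⊎_)
open import Relation.Binary.Bundles using (Poset)
open import Relation.Binary.PropositionalEquality using (_≡_)

module PosetOps {c ℓ₁ ℓ₂ : Level} (P : Poset c ℓ₁ ℓ₂) where
  open Poset P

  Subset : Set (suc (c ⊔ ℓ₁ ⊔ ℓ₂))
  Subset = Carrier → Set (c ⊔ ℓ₁ ⊔ ℓ₂)

  _≐_ : Subset → Subset → Set (c ⊔ ℓ₁ ⊔ ℓ₂)
  A ≐ B = (∀ p → A p → B p) × (∀ p → B p → A p)

  Whole : Subset
  Whole _ = Level.Lift _ Data.Unit.⊤
    where import Data.Unit

  _∪_ : Subset → Subset → Subset
  (A ∪ B) p = A p ⊎ B p

  ⟦_⟧ : Carrier → Subset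
  ⟦ a ⟧ p = Level.Lift (c ⊔ ℓ₂) (p ≈ a)

  ⟦_,_⟧ : Carrier → Carrier → Subset
  ⟦ a , b ⟧ = ⟦ a ⟧ ∪ ⟦ b ⟧

  L : Subset → Subset
  L A p = ∀ a → A a → p ≤ a

  U : Subset → Subset
  U A p = ∀ a → A a → a ≤ p

  IsComplement : Carrier → Carrier → Set (c ⊔ ℓ₁ ⊔ ℓ₂)
  IsComplement b a = (L (U ⟦ a , b ⟧) ≐ Whole) × (U (L ⟦ a , b ⟧) ≐ Whole)

  IsDistributiveTriple : Carrier → Carrier → Carrier → Set (c ⊔ ℓ₁ ⊔ ℓ₂)
  IsDistributiveTriple a b d =
    L (U ⟦ a , b ⟧ ∪ ⟦ d ⟧) ≐ L (U (L ⟦ a , d ⟧ ∪ L ⟦ b , d ⟧))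

{-# OPTIONS --safe #-}
-- The element y lies in L(U(x,z), y) because LU(x,z) = P, while z lies in U(L(x,y), L(z,y))
-- because UL(x,y) = P; distributivity equates L(U(x,z), y) with
-- LU(L(x,y), L(z,y)), so y ≤ z. The other triple gives z ≤ y.
module Submission where

open import Defs
open import Level using (Level; lift)
open import Relation.Binary.Bundles using (Poset)
open import Data.Product using (proj₁; proj₂)
open import Data.Sum using (inj₁; inj₂)

module _ {c ℓ₁ ℓ₂ : Level} (P : Poset c ℓ₁ ℓ₂) where
  open Poset P
  open PosetOps P

  L-∪ : ∀ {A B p} → L A p → L B p → L (A ∪ B) p
  L-∪ pA pB a (inj₁ aA) = pA a aA
  L-∪ pA pB a (inj₂ aB) = pB a aB

  U-∪ : ∀ {A B p} → U A p → U B p → U (A ∪ B) p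
  U-∪ pA pB a (inj₁ aA) = pA a aA
  U-∪ pA pB a (inj₂ aB) = pB a aB

  ≤⇒L⟦⟧ : ∀ {p a} → p ≤ a → L ⟦ a ⟧ p
  ≤⇒L⟦⟧ p≤a b (lift b≈a) = trans p≤a (reflexive (Eq.sym b≈a))

  U-L⟦,⟧ : ∀ {a b} → U (L ⟦ a , b ⟧) a
  U-L⟦,⟧ q q≤ab = q≤ab _ (inj₁ (lift Eq.refl))

  complement⇒LU : ∀ {a b} → IsComplement b a → ∀ p → L (U ⟦ a , b ⟧) p
  complement⇒LU comp p = proj₂ (proj₁ comp) p _

  complement⇒UL : ∀ {a b} → IsComplement b a → ∀ p → U (L ⟦ a , b ⟧) p
  complement⇒UL comp p = proj₂ (proj₂ comp) p _

  distributive-complements⇒≤ : ∀ {x y z} → IsComplement y x → IsComplement z x →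
                               IsDistributiveTriple x z y → y ≤ z
  distributive-complements⇒≤ {x} {y} {z} cy cz dt =
    proj₁ dt y y∈L[U[x,z],y] z z∈U[L[x,y],L[z,y]]
    where
    y∈L[U[x,z],y] : L (U ⟦ x , z ⟧ ∪ ⟦ y ⟧) y
    y∈L[U[x,z],y] = L-∪ (complement⇒LU cz y) (≤⇒L⟦⟧ refl)

    z∈U[L[x,y],L[z,y]] : U (L ⟦ x , y ⟧ ∪ L ⟦ z , y ⟧) z
    z∈U[L[x,y],L[z,y]] = U-∪ (complement⇒UL cy z) U-L⟦,⟧

lemma2 : ∀ {c ℓ₁ ℓ₂ : Level} (P : Poset c ℓ₁ ℓ₂) (x y z : Poset.Carrier P) →
    PosetOps.IsComplement P y x → PosetOps.IsComplement P z x →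
    PosetOps.IsDistributiveTriple P x y z → PosetOps.IsDistributiveTriple P x z y →
    Poset._≈_ P y z
lemma2 P x y z cy cz dt-xyz dt-xzy =
  Poset.antisym P (distributive-complements⇒≤ P cy cz dt-xzy)
                  (distributive-complements⇒≤ P cz cy dt-xyz)
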